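{- Let $m,n\in\mathbb{N}$. Then (1) the complete bipartite graph $K_{1,n}$ is an $\mathcal{N}$ position of Grim; (2) if $m,n>1$, then $K_{m,n}$ is an $\mathcal{N}$ position if and only if $m+n$ is odd.
   Context: Grim: two players alternate moves on a finite simple undirected graph. Before play, isolated vertices are deleted. A move consists of choosing a remaining vertex and deleting it together with its incident edges, and then deleting every vertex that has become isolated. The player making the last move wins (a player with no available move loses). A graph is an $\mathcal{N}$ position if the player about to move has a winning strategy, and a $\mathcal{P}$ position otherwise. -}

module Defs where

open import Data.Nat using (ℕ; zero; suc; _+_; _<ᵇ_)
open import Data.Fin using (Fin; toℕ; _≟_)
open import Data.Bool using (Bool; true; false; _∧_; _∨_; not; _xor_)
open import Relation.Nullary.Decidable using (⌊_⌋)
open import Relation.Binary.PropositionalEquality using (_≡_; refl)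

record SimpleGraph (n : ℕ) : Set where
  field
    adj   : Fin n → Fin n → Bool
    sym   : ∀ u v → adj u v ≡ adj v u
    irrfl : ∀ v → adj v v ≡ false
open SimpleGraph public

-- Sets of remaining vertices, as characteristic functions.
VSet : ℕ → Set
VSet n = Fin n → Bool

anyF : ∀ {n} → (Fin n → Bool) → Bool
anyF {zero}  f = false
anyF {suc n} f = f Fin.zero ∨ anyF (λ i → f (Fin.suc i))

hasNbr : ∀ {n} → SimpleGraph n → VSet n → Fin n → Bool
hasNbr G S u = anyF (λ w → S w ∧ adj G u w)

clean : ∀ {n} → SimpleGraph n → VSet n → VSet n
clean G S u = S u ∧ hasNbr G S u

move : ∀ {n} → SimpleGraph n → VSet n → Fin n → VSet n
move G S v = clean G (λ u → S u ∧ not ⌊ u ≟ v ⌋)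

start : ∀ {n} → SimpleGraph n → VSet n
start G = clean G (λ _ → true)

data Win  {n} (G : SimpleGraph n) (S : VSet n) : Set
data Lose {n} (G : SimpleGraph n) (S : VSet n) : Set

data Win G S where
  win : ∀ v → S v ≡ true → Lose G (move G S v) → Win G S

data Lose G S where
  lose : (∀ v → S v ≡ true → Win G (move G S v)) → Lose G S

NPosition : ∀ {n} → SimpleGraph n → Set
NPosition G = Win G (start G)

PPosition : ∀ {n} → SimpleGraph n → Set
PPosition G = Lose G (start G)

private
  xor-sym : ∀ a b → a xor b ≡ b xor a
  xor-sym false false = refl
  xor-sym false true  = refl
  xor-sym true  false = refl
  xor-sym true  true  = refl

  xor-self : ∀ a → a xor a ≡ false
  xor-self false = refl
  xor-self true  = refl

K : (m n : ℕ) → SimpleGraph (m + n)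
K m n = record
  { adj   = λ i j → (toℕ i <ᵇ m) xor (toℕ j <ᵇ m)
  ; sym   = λ i j → xor-sym (toℕ i <ᵇ m) (toℕ j <ᵇ m)
  ; irrfl = λ i → xor-self (toℕ i <ᵇ m)
  }

module Submission where

-- A position reached from K_{m,n} is described by the numbers of vertices left on the
-- two sides: a move shrinks one side by one, and once a side is empty the other side
-- has become isolated and vanishes too. So if a side has a single vertex, removing it
-- wins. With both sides of size at least 2, whoever brings a side down to one vertex
-- loses, so the players remove vertices keeping both sides at least 2, and the player
-- facing two sides of size 2 is stuck: from sides 2 + a and 2 + b the first player
-- wins exactly when a + b, equivalently m + n, is odd.

open import Defs
open import Data.Nat using (ℕ; _+_; _%_; _≤_; _<_)
open import Data.Product using (_×_)
open import Function.Bundles using (_⇔_)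
open import Relation.Binary.PropositionalEquality using (_≡_)

open import Algebra.Bundles using (CommutativeMonoid)
open import Data.Bool using (Bool; true; false; _∧_; not; _xor_; if_then_else_)
open import Data.Bool.Properties
  using (∧-identityʳ; ∧-zeroʳ; ∧-conicalˡ; ∧-conicalʳ; not-involutive; ∧-commutativeMonoid)
open import Data.Fin as Fin using (Fin; toℕ; _≟_)
open import Data.Nat using (zero; suc; _<ᵇ_; s≤s)
open import Data.Nat.Properties using (+-suc; +-comm; +-identityʳ; suc-injective)
open import Data.Product using (∃; _,_)
open import Data.Sum using (_⊎_; inj₁; inj₂)
open import Function using (_∘_)
open import Function.Bundles using (mk⇔)
open import Relation.Binary.PropositionalEquality using (refl; trans; cong; cong₂)
import Relation.Binary.PropositionalEquality as ≡
open import Relation.Nullary using (¬_; yes; no; contradiction)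
open import Relation.Nullary.Decidable using (⌊_⌋)

open import Algebra.Properties.CommutativeSemigroup
  (CommutativeMonoid.commutativeSemigroup ∧-commutativeMonoid) using (xy∙z≈xz∙y)

count : ∀ {n} → (Fin n → Bool) → ℕ
count {zero}  f = 0
count {suc n} f = if f Fin.zero then suc (count (f ∘ Fin.suc)) else count (f ∘ Fin.suc)

count-cong : ∀ {n} {f g : Fin n → Bool} → (∀ i → f i ≡ g i) → count f ≡ count g
count-cong {zero}  f≗g = refl
count-cong {suc n} f≗g rewrite f≗g Fin.zero | count-cong (f≗g ∘ Fin.suc) = refl

count-false : ∀ n → count {n} (λ _ → false) ≡ 0
count-false zero    = refl
count-false (suc n) = count-false n

count-true : ∀ n → count {n} (λ _ → true) ≡ n
count-true zero    = refl
count-true (suc n) = cong suc (count-true n)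

count-<ᵇ : ∀ k n → count {k + n} (λ i → toℕ i <ᵇ k) ≡ k
count-<ᵇ zero    n = count-false n
count-<ᵇ (suc k) n = cong suc (count-<ᵇ k n)

count-≮ᵇ : ∀ k n → count {k + n} (λ i → not (toℕ i <ᵇ k)) ≡ n
count-≮ᵇ zero    n = count-true n
count-≮ᵇ (suc k) n = count-≮ᵇ k n

anyF≡0<ᵇcount : ∀ {n} (f : Fin n → Bool) → anyF f ≡ (0 <ᵇ count f)
anyF≡0<ᵇcount {zero}  f = refl
anyF≡0<ᵇcount {suc n} f with f Fin.zero
... | true  = refl
... | false = anyF≡0<ᵇcount (f ∘ Fin.suc)

count≡suc⇒∃ : ∀ {n} (f : Fin n → Bool) {k} → count f ≡ suc k → ∃ λ i → f i ≡ true
count≡suc⇒∃ {suc n} f eq with f Fin.zero in f0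
... | true  = Fin.zero , f0
... | false with count≡suc⇒∃ (f ∘ Fin.suc) eq
...   | i , fi = Fin.suc i , fi

count≡0⇒≡false : ∀ {n} (f : Fin n → Bool) → count f ≡ 0 → ∀ i → f i ≡ false
count≡0⇒≡false {suc n} f eq i with f Fin.zero in f0
count≡0⇒≡false {suc n} f ()  i           | true
count≡0⇒≡false {suc n} f eq  Fin.zero    | false = f0
count≡0⇒≡false {suc n} f eq  (Fin.suc i) | false = count≡0⇒≡false (f ∘ Fin.suc) eq i

count-∧ʳ : ∀ {n} (f : Fin n → Bool) b → count (λ i → f i ∧ b) ≡ (if b then count f else 0)
count-∧ʳ         f true  = count-cong (λ i → ∧-identityʳ (f i))
count-∧ʳ {zero}  f false = refl
count-∧ʳ {suc n} f false rewrite ∧-zeroʳ (f Fin.zero) = count-∧ʳ (f ∘ Fin.suc) false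

delete : ∀ {n} → VSet n → Fin n → VSet n
delete S v u = S u ∧ not ⌊ u ≟ v ⌋

suc≟suc : ∀ {n} (i v : Fin n) → ⌊ Fin.suc i ≟ Fin.suc v ⌋ ≡ ⌊ i ≟ v ⌋
suc≟suc i v with i ≟ v
... | yes _ = refl
... | no  _ = refl

count-delete-suc : ∀ {n} (f : Fin (suc n) → Bool) v →
                   count (delete f (Fin.suc v) ∘ Fin.suc) ≡ count (delete (f ∘ Fin.suc) v)
count-delete-suc f v = count-cong λ i → cong (λ b → f (Fin.suc i) ∧ not b) (suc≟suc i v)

count-delete-member : ∀ {n} (f : Fin n → Bool) v → f v ≡ true → count f ≡ suc (count (delete f v))
count-delete-member {suc n} f Fin.zero fv rewrite fv =
  cong suc (count-cong λ i → ≡.sym (∧-identityʳ (f (Fin.suc i))))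
count-delete-member {suc n} f (Fin.suc v) fv
  rewrite ∧-identityʳ (f Fin.zero) | count-delete-suc f v with f Fin.zero
... | true  = cong suc (count-delete-member (f ∘ Fin.suc) v fv)
... | false = count-delete-member (f ∘ Fin.suc) v fv

count-delete-nonmember : ∀ {n} (f : Fin n → Bool) v → f v ≡ false → count f ≡ count (delete f v)
count-delete-nonmember {suc n} f Fin.zero fv rewrite fv =
  count-cong λ i → ≡.sym (∧-identityʳ (f (Fin.suc i)))
count-delete-nonmember {suc n} f (Fin.suc v) fv
  rewrite ∧-identityʳ (f Fin.zero) | count-delete-suc f v with f Fin.zero
... | true  = cong suc (count-delete-nonmember (f ∘ Fin.suc) v fv)
... | false = count-delete-nonmember (f ∘ Fin.suc) v fv

win⇒¬lose : ∀ {k} {G : SimpleGraph k} {S} → Win G S → ¬ Lose G S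
win⇒¬lose (win v Sv l) (lose f) = win⇒¬lose (f v Sv) l

lose-if-empty : ∀ {k} {G : SimpleGraph k} {S} → (∀ v → S v ≡ false) → Lose G S
lose-if-empty empty = lose λ v Sv → contradiction (trans (≡.sym Sv) (empty v)) λ ()

suc-odd⇒even : ∀ k → suc k % 2 ≡ 1 → k % 2 ≡ 0
suc-odd⇒even zero          _ = refl
suc-odd⇒even (suc zero)    ()
suc-odd⇒even (suc (suc k)) h = suc-odd⇒even k h

suc-even⇒odd : ∀ k → suc k % 2 ≡ 0 → k % 2 ≡ 1
suc-even⇒odd zero          ()
suc-even⇒odd (suc zero)    _ = refl
suc-even⇒odd (suc (suc k)) h = suc-even⇒odd k h

%2≡0⊎%2≡1 : ∀ k → k % 2 ≡ 0 ⊎ k % 2 ≡ 1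
%2≡0⊎%2≡1 zero          = inj₁ refl
%2≡0⊎%2≡1 (suc zero)    = inj₂ refl
%2≡0⊎%2≡1 (suc (suc k)) = %2≡0⊎%2≡1 k

module CompleteBipartite (m n : ℕ) where

  G : SimpleGraph (m + n)
  G = K m n

  side : Fin (m + n) → Bool
  side i = toℕ i <ᵇ m

  onSide : Bool → Fin (m + n) → Bool
  onSide true  = side
  onSide false = not ∘ side

  size : Bool → VSet (m + n) → ℕ
  size s S = count (λ u → S u ∧ onSide s u)

  Sizes : Bool → VSet (m + n) → ℕ → ℕ → Set
  Sizes s S x y = size s S ≡ x × size (not s) S ≡ y

  Sizes-swap : ∀ s {S x y} → Sizes s S x y → Sizes (not s) S y x
  Sizes-swap true  (sx , sy) = sy , sx
  Sizes-swap false (sx , sy) = sy , sx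

  onSide-not : ∀ s u → onSide (not s) u ≡ not (onSide s u)
  onSide-not true  u = refl
  onSide-not false u = ≡.sym (not-involutive (side u))

  onSide⇒side : ∀ s u → onSide s u ≡ true → side u ≡ s
  onSide⇒side true  u e = e
  onSide⇒side false u e = trans (≡.sym (not-involutive (side u))) (cong not e)

  hasNbr-onSide : ∀ s S u → side u ≡ s → hasNbr G S u ≡ (0 <ᵇ size (not s) S)
  hasNbr-onSide _ S u refl =
    trans (anyF≡0<ᵇcount (λ w → S w ∧ adj G u w))
          (cong (0 <ᵇ_) (count-cong λ w → cong (S w ∧_) (xor-side (side u) w)))
    where
    xor-side : ∀ s w → s xor side w ≡ onSide (not s) w
    xor-side true  w = refl
    xor-side false w = refl

  size-clean : ∀ s S → size s (clean G S) ≡ (if 0 <ᵇ size (not s) S then size s S else 0)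
  size-clean s S = trans (count-cong pointwise) (count-∧ʳ (λ u → S u ∧ onSide s u) _)
    where
    pointwise : ∀ u → (S u ∧ hasNbr G S u) ∧ onSide s u ≡ (S u ∧ onSide s u) ∧ (0 <ᵇ size (not s) S)
    pointwise u with onSide s u in e
    ... | true  rewrite hasNbr-onSide s S u (onSide⇒side s u e) = xy∙z≈xz∙y (S u) _ true
    ... | false = trans (∧-zeroʳ _) (cong (_∧ _) (≡.sym (∧-zeroʳ (S u))))

  sizes-clean : ∀ s {S x y} → Sizes s S x y →
                Sizes s (clean G S) (if 0 <ᵇ y then x else 0) (if 0 <ᵇ x then y else 0)
  sizes-clean true  {S} (refl , refl) = size-clean true S , size-clean false S
  sizes-clean false {S} (refl , refl) = size-clean false S , size-clean true S

  size-delete-member : ∀ s S v → S v ≡ true → onSide s v ≡ true → size s S ≡ suc (size s (delete S v))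
  size-delete-member s S v Sv sv =
    trans (count-delete-member _ v (cong₂ _∧_ Sv sv)) (cong suc (count-cong λ u → xy∙z≈xz∙y (S u) _ _))

  size-delete-nonmember : ∀ s S v → onSide s v ≡ false → size s S ≡ size s (delete S v)
  size-delete-nonmember s S v sv =
    trans (count-delete-nonmember _ v (trans (cong (S v ∧_) sv) (∧-zeroʳ (S v))))
          (count-cong λ u → xy∙z≈xz∙y (S u) _ _)

  sizes-move : ∀ s {S v a b} → S v ≡ true → onSide s v ≡ true → Sizes s S (suc a) b →
               Sizes s (move G S v) (if 0 <ᵇ b then a else 0) (if 0 <ᵇ a then b else 0)
  sizes-move s {S} {v} Sv sv (sa , sb) = sizes-clean s
    ( suc-injective (trans (≡.sym (size-delete-member s S v Sv sv)) sa)
    , trans (≡.sym (size-delete-nonmember (not s) S v (trans (onSide-not s v) (cong not sv)))) sb )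

  win-by-moving-on : ∀ s {S a b} → Sizes s S (suc a) (suc b) →
                     (∀ {T} → Sizes s T a (if 0 <ᵇ a then suc b else 0) → Lose G T) → Win G S
  win-by-moving-on s {S} sizes@(sa , _) next with count≡suc⇒∃ _ sa
  ... | v , Sv∧sv = win v Sv (next (sizes-move s Sv (∧-conicalʳ (S v) _ Sv∧sv) sizes))
    where
    Sv : S v ≡ true
    Sv = ∧-conicalˡ (S v) _ Sv∧sv

  lose-if-no-vertices : ∀ s {S} → Sizes s S 0 0 → Lose G S
  lose-if-no-vertices s {S} (s0 , o0) = lose-if-empty λ v →
    on-neither (S v) (onSide s v)
      (count≡0⇒≡false _ s0 v)
      (trans (≡.sym (cong (S v ∧_) (onSide-not s v))) (count≡0⇒≡false _ o0 v))
    where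
    on-neither : ∀ x y → x ∧ y ≡ false → x ∧ not y ≡ false → x ≡ false
    on-neither false y _ _ = refl
    on-neither true false _ ()
    on-neither true true () _

  singleton-side-wins : ∀ s {S b} → Sizes s S 1 (suc b) → Win G S
  singleton-side-wins s sizes = win-by-moving-on s sizes (lose-if-no-vertices s)

  -- The measure t = a + b replaces structural recursion on a and b, which the
  -- termination checker rejects because the two sides swap roles.
  mutual
    odd-wins : ∀ t s a b {S} → Sizes s S (2 + a) (2 + b) → a + b ≡ t → t % 2 ≡ 1 → Win G S
    odd-wins zero    s a       b       _     _     ()
    odd-wins (suc t) s (suc a) b       sizes total odd = win-by-moving-on s sizes λ sizes′ →
      even-loses t s a b sizes′ (suc-injective total) (suc-odd⇒even t odd)
    odd-wins (suc t) s zero    (suc b) sizes total odd =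
      win-by-moving-on (not s) (Sizes-swap s sizes) λ sizes′ →
        even-loses t (not s) b zero sizes′ (trans (+-identityʳ b) (suc-injective total)) (suc-odd⇒even t odd)
    odd-wins (suc t) s zero    zero    _     ()    _

    even-loses : ∀ t s a b {S} → Sizes s S (2 + a) (2 + b) → a + b ≡ t → t % 2 ≡ 0 → Lose G S
    even-loses t s a b {S} sizes total even = lose reply
      where
      reply : ∀ v → S v ≡ true → Win G (move G S v)
      reply v Sv with onSide s v in sv
      ... | true  = win-after-shrinking t s a b (sizes-move s Sv sv sizes) total even
      ... | false = win-after-shrinking t (not s) b a
                      (sizes-move (not s) Sv (trans (onSide-not s v) (cong not sv)) (Sizes-swap s sizes))
                      (trans (+-comm b a) total) even

    win-after-shrinking : ∀ t s a b {T} → Sizes s T (suc a) (2 + b) → a + b ≡ t → t % 2 ≡ 0 → Win G T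
    win-after-shrinking t       s zero    b sizes _     _    = singleton-side-wins s sizes
    win-after-shrinking zero    s (suc a) b _     ()    _
    win-after-shrinking (suc t) s (suc a) b sizes total even =
      odd-wins t s a b sizes (suc-injective total) (suc-even⇒odd t even)

  sizes-start : Sizes true (start G) (if 0 <ᵇ n then m else 0) (if 0 <ᵇ m then n else 0)
  sizes-start = sizes-clean true (count-<ᵇ m n , count-≮ᵇ m n)

open CompleteBipartite using (sizes-start; singleton-side-wins; odd-wins; even-loses)

[2+a]+[2+b]%2≡[a+b]%2 : ∀ a b → (2 + a + (2 + b)) % 2 ≡ (a + b) % 2
[2+a]+[2+b]%2≡[a+b]%2 a b = cong (_% 2) (trans (+-suc a (suc b)) (cong suc (+-suc a b)))

theorem3p2 : ((n : ℕ) → 1 ≤ n → NPosition (K 1 n))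
           × ((m n : ℕ) → 1 < m → 1 < n → (NPosition (K m n) ⇔ ((m + n) % 2 ≡ 1)))
theorem3p2 = star-wins , balanced-wins-iff-odd
  where
  star-wins : (n : ℕ) → 1 ≤ n → NPosition (K 1 n)
  star-wins (suc n) _ = singleton-side-wins 1 (suc n) true (sizes-start 1 (suc n))

  balanced-wins-iff-odd : (m n : ℕ) → 1 < m → 1 < n → (NPosition (K m n) ⇔ ((m + n) % 2 ≡ 1))
  balanced-wins-iff-odd (suc zero)    _             (s≤s ()) _
  balanced-wins-iff-odd (suc (suc a)) (suc zero)    _        (s≤s ())
  balanced-wins-iff-odd (suc (suc a)) (suc (suc b)) _        _        = mk⇔ to from
    where
    open CompleteBipartite (2 + a) (2 + b) using (Sizes)

    parity : (2 + a + (2 + b)) % 2 ≡ (a + b) % 2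
    parity = [2+a]+[2+b]%2≡[a+b]%2 a b

    start-sizes : Sizes true (start (K (2 + a) (2 + b))) (2 + a) (2 + b)
    start-sizes = sizes-start (2 + a) (2 + b)

    to : NPosition (K (2 + a) (2 + b)) → (2 + a + (2 + b)) % 2 ≡ 1
    to n-position with %2≡0⊎%2≡1 (a + b)
    ... | inj₁ even = contradiction (even-loses (2 + a) (2 + b) _ true a b start-sizes refl even)
                                    (win⇒¬lose n-position)
    ... | inj₂ odd  = trans parity odd

    from : (2 + a + (2 + b)) % 2 ≡ 1 → NPosition (K (2 + a) (2 + b))
    from odd = odd-wins (2 + a) (2 + b) _ true a b start-sizes refl (trans (≡.sym parity) odd)
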